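{- Let $G$ be a cobipartite graph $(A,B)$ and let $u\in A$, $v\in B$ be such that $uv$ is a cosimplicial non-edge of $G$. Then $\{u,v\}$ is a strong stable set of $G$.
   Context: Graphs are finite and simple. A cobipartite graph $(A,B)$ is a graph whose vertex set is partitioned into two cliques $A,B$. Two sets $X,Y$ are complete to each other if they are disjoint and every vertex of $X$ is adjacent to every vertex of $Y$. An edge $xy$ of a graph $H$ is simplicial if $N_H(x)$ is complete to $N_H(y)$ in $H$. A pair $uv$ of vertices of $G$ is a cosimplicial non-edge if $uv$ is a simplicial edge of the complement $G^C$. A stable set is strong if it meets every maximal clique. -}

module Defs where

open import Data.Nat using (ℕ)
open import Data.Fin using (Fin)
open import Data.Fin.Subset using (Subset; _∈_; _∉_; _⊆_)
open import Data.Product using (Σ; _×_; _,_; ∃; ∃-syntax)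
open import Relation.Binary.PropositionalEquality using (sym; refl)
open import Data.Sum using (_⊎_)
open import Relation.Nullary using (¬_; Dec)
open import Relation.Binary.PropositionalEquality using (_≡_; _≢_)
open import Level using (0ℓ)

record Graph (n : ℕ) : Set₁ where
  field
    Adj      : Fin n → Fin n → Set
    adj-dec  : ∀ x y → Dec (Adj x y)
    adj-sym  : ∀ {x y} → Adj x y → Adj y x
    adj-irr  : ∀ {x} → ¬ Adj x x
open Graph public

complement : ∀ {n} → Graph n → Graph n
complement {n} G = record
  { Adj     = λ x y → x ≢ y × ¬ Adj G x y
  ; adj-dec = dec
  ; adj-sym = λ { (x≢y , ¬a) → (λ e → x≢y (sym e)) , (λ a → ¬a (adj-sym G a)) }
  ; adj-irr = λ { (x≢x , _) → x≢x refl }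
  }
  where
  open import Relation.Nullary using (yes; no)
  open import Data.Fin using (_≟_)
  open import Relation.Nullary.Decidable using (_×-dec_; ¬?)
  dec : ∀ x y → Dec (x ≢ y × ¬ Adj G x y)
  dec x y = ¬? (x ≟ y) ×-dec ¬? (adj-dec G x y)

module _ {n : ℕ} (G : Graph n) where

  Pred : Set₁
  Pred = Fin n → Set

  N : Fin n → Pred
  N x y = Adj G x y

  CompleteTo : Pred → Pred → Set
  CompleteTo X Y = (∀ z → X z → ¬ Y z) × (∀ x y → X x → Y y → Adj G x y)

  SimplicialEdge : Fin n → Fin n → Set
  SimplicialEdge x y = Adj G x y × CompleteTo (N x) (N y)

  IsClique : Subset n → Set
  IsClique S = ∀ x y → x ∈ S → y ∈ S → x ≢ y → Adj G x y

  IsMaximalClique : Subset n → Set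
  IsMaximalClique S = IsClique S × (∀ T → IsClique T → S ⊆ T → T ⊆ S)

  IsStable : Subset n → Set
  IsStable S = ∀ x y → x ∈ S → y ∈ S → ¬ Adj G x y

  IsStrongStable : Subset n → Set
  IsStrongStable S = IsStable S × (∀ K → IsMaximalClique K → ∃[ x ] (x ∈ S × x ∈ K))

  IsCobipartite : Subset n → Subset n → Set
  IsCobipartite A B =
    (∀ x → x ∈ A ⊎ x ∈ B) × (∀ x → x ∈ A → x ∉ B) × IsClique A × IsClique B

CosimplicialNonEdge : ∀ {n} → Graph n → Fin n → Fin n → Set
CosimplicialNonEdge G u v = SimplicialEdge (complement G) u v

-- Let uv be a cosimplicial non-edge of G, i.e. u and v are non-adjacent and
-- every non-neighbour of u is non-adjacent to every non-neighbour of v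
-- (neighbourhoods taken in the complement G^C).  Then {u, v} is stable, and
-- it meets every maximal clique K: otherwise u, v ∉ K, and since K is
-- maximal neither u nor v is adjacent to all of K, giving x ∈ K non-adjacent
-- to u and y ∈ K non-adjacent to v.  Cosimpliciality makes x and y distinct
-- and non-adjacent, contradicting that K is a clique.
module Submission where

open import Defs
open import Data.Nat using (ℕ)
open import Data.Fin using (Fin)
open import Data.Fin.Properties using (any?)
open import Data.Fin.Subset using (Subset; _∈_; _∉_; ⁅_⁆; _∪_)
open import Data.Fin.Subset.Properties using (_∈?_; x∈⁅x⁆; x∈⁅y⁆⇒x≡y; x∈p∪q⁻; x∈p∪q⁺)
open import Data.Product using (_×_; _,_; ∃-syntax)
open import Data.Sum using (_⊎_; inj₁; inj₂)
open import Data.Empty using (⊥-elim)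
open import Relation.Nullary using (¬_; yes; no; contradiction)
open import Relation.Nullary.Decidable using (_×-dec_; ¬?)
open import Relation.Binary.PropositionalEquality using (_≡_; refl; sym; trans; subst)

module _ {n : ℕ} (G : Graph n) where

  clique-extend : (K : Subset n) (u : Fin n) → IsClique G K →
                  (∀ x → x ∈ K → Adj G u x) → IsClique G (K ∪ ⁅ u ⁆)
  clique-extend K u clique-K u-dominates x y x∈ y∈ x≢y
    with x∈p∪q⁻ K ⁅ u ⁆ x∈ | x∈p∪q⁻ K ⁅ u ⁆ y∈
  ... | inj₁ x∈K | inj₁ y∈K = clique-K x y x∈K y∈K x≢y
  ... | inj₂ x∈u | inj₁ y∈K rewrite x∈⁅y⁆⇒x≡y u x∈u = u-dominates y y∈K
  ... | inj₁ x∈K | inj₂ y∈u rewrite x∈⁅y⁆⇒x≡y u y∈u = adj-sym G (u-dominates x x∈K)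
  ... | inj₂ x∈u | inj₂ y∈u = ⊥-elim (x≢y (trans (x∈⁅y⁆⇒x≡y u x∈u) (sym (x∈⁅y⁆⇒x≡y u y∈u))))

  -- A vertex outside a maximal clique K is not adjacent to all of K,
  -- since otherwise K ∪ {u} would be a strictly larger clique.
  maximal-clique-undominated : (K : Subset n) (u : Fin n) →
    IsMaximalClique G K → u ∉ K → ¬ (∀ x → x ∈ K → Adj G u x)
  maximal-clique-undominated K u (clique-K , maximal-K) u∉K u-dominates =
    u∉K (maximal-K (K ∪ ⁅ u ⁆) (clique-extend K u clique-K u-dominates)
                   (λ x∈K → x∈p∪q⁺ (inj₁ x∈K)) (x∈p∪q⁺ (inj₂ (x∈⁅x⁆ u))))

  -- The same fact stated positively: u has a non-neighbour x in K, which is a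
  -- neighbour of u in the complement.  Finite search makes this constructive.
  maximal-clique-non-neighbour : (K : Subset n) (u : Fin n) →
    IsMaximalClique G K → u ∉ K → ∃[ x ] (x ∈ K × Adj (complement G) u x)
  maximal-clique-non-neighbour K u max-K u∉K
    with any? (λ x → (x ∈? K) ×-dec ¬? (adj-dec G u x))
  ... | yes (x , x∈K , ¬ux) = x , x∈K , (λ u≡x → u∉K (subst (_∈ K) (sym u≡x) x∈K)) , ¬ux
  ... | no none = ⊥-elim (maximal-clique-undominated K u max-K u∉K u-dominates)
    where
    u-dominates : ∀ x → x ∈ K → Adj G u x
    u-dominates x x∈K with adj-dec G u x
    ... | yes ux = ux
    ... | no ¬ux = contradiction (x , x∈K , ¬ux) none

  pair-member : ∀ {u v x : Fin n} → x ∈ ⁅ u ⁆ ∪ ⁅ v ⁆ → x ≡ u ⊎ x ≡ v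
  pair-member {u} {v} x∈ with x∈p∪q⁻ ⁅ u ⁆ ⁅ v ⁆ x∈
  ... | inj₁ x∈u = inj₁ (x∈⁅y⁆⇒x≡y u x∈u)
  ... | inj₂ x∈v = inj₂ (x∈⁅y⁆⇒x≡y v x∈v)

  pair-stable : (u v : Fin n) → ¬ Adj G u v → IsStable G (⁅ u ⁆ ∪ ⁅ v ⁆)
  pair-stable u v ¬uv x y x∈ y∈ xy with pair-member x∈ | pair-member y∈
  ... | inj₁ refl | inj₁ refl = adj-irr G xy
  ... | inj₂ refl | inj₂ refl = adj-irr G xy
  ... | inj₁ refl | inj₂ refl = ¬uv xy
  ... | inj₂ refl | inj₁ refl = ¬uv (adj-sym G xy)

  -- If N_{G^C}(u) is complete to N_{G^C}(v) in G^C, every maximal clique of G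
  -- contains u or v: non-neighbours x of u and y of v inside K would have to
  -- be distinct and non-adjacent, yet both lie in the clique K.
  cosimplicial-meets-maximal-cliques : (u v : Fin n) →
    CompleteTo (complement G) (N (complement G) u) (N (complement G) v) →
    ∀ K → IsMaximalClique G K → ∃[ x ] (x ∈ ⁅ u ⁆ ∪ ⁅ v ⁆ × x ∈ K)
  cosimplicial-meets-maximal-cliques u v (_ , complete) K max-K@(clique-K , _)
    with u ∈? K | v ∈? K
  ... | yes u∈K | _ = u , x∈p∪q⁺ (inj₁ (x∈⁅x⁆ u)) , u∈K
  ... | no _ | yes v∈K = v , x∈p∪q⁺ (inj₂ (x∈⁅x⁆ v)) , v∈K
  ... | no u∉K | no v∉K
    with maximal-clique-non-neighbour K u max-K u∉K
       | maximal-clique-non-neighbour K v max-K v∉K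
  ... | x , x∈K , x∈N̄u | y , y∈K , y∈N̄v
    with complete x y x∈N̄u y∈N̄v
  ... | x≢y , ¬xy = ⊥-elim (¬xy (clique-K x y x∈K y∈K x≢y))

lemma3p13 : ∀ {n : ℕ} (G : Graph n) (A B : Subset n) (u v : Fin n) →
    IsCobipartite G A B → u ∈ A → v ∈ B → CosimplicialNonEdge G u v →
    IsStrongStable G (⁅ u ⁆ ∪ ⁅ v ⁆)
lemma3p13 G A B u v _ _ _ ((_ , ¬uv) , nbhds-complete) =
  pair-stable G u v ¬uv , cosimplicial-meets-maximal-cliques G u v nbhds-complete
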